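{- Let $t$ be a well-typed term of $\mathsf{RSLR}$. If $t\rightarrow v_1,v_2$ and $t\rightarrow z_1,z_2$, where the sequences $(v_1,v_2)$ and $(z_1,z_2)$ are different, then there exist terms $a_1,a_2,a_3,a_4$ such that $v_1\rightarrow a_1,a_2$ and $v_2\rightarrow a_3,a_4$, and there is $i\in\{1,2\}$ with $z_i\rightarrow a_1,a_3$ and $z_{3-i}\rightarrow a_2,a_4$.
   Context: $\mathsf{RSLR}$: types $A::=\mathbf{N}\mid aA\rightarrow A$ with aspects $a\in\{\square,\blacksquare\}$ ordered by $\square<:\square,\square<:\blacksquare,\blacksquare<:\blacksquare$; $H$ ranges over types other than $\mathbf{N}$; subtyping is the least reflexive transitive relation with $aA\rightarrow C<:bB\rightarrow D$ when $B<:A$, $C<:D$, $b<:a$; a type is $\square$-free if $\square$ does not occur in it. Terms: $t::=x\mid c\mid ts\mid\lambda x:aA.t\mid\mathtt{case}_A\,t\ \mathtt{zero}\ s\ \mathtt{even}\ r\ \mathtt{odd}\ q\mid\mathtt{recursion}_A\,t\,s\,r$, constants $c::=n\mid S_0\mid S_1\mid P\mid\mathtt{rand}$ ($n$ numerals), typed $n,\mathtt{rand}:\mathbf{N}$, $S_0,S_1,P:\blacksquare\mathbf{N}\rightarrow\mathbf{N}$. Contexts are finite sets $x:aA$; $\Gamma;\Delta$ is a disjoint union with all types of $\Gamma$ equal to $\mathbf{N}$; $\Gamma<:a$ means all aspects in $\Gamma$ are $<:a$. Typing: variable, subsumption, $\lambda$-introduction ($\Gamma,x:aA\vdash t:B\Rightarrow\Gamma\vdash\lambda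 x:aA.t:aA\rightarrow B$), constants; case (from $\Gamma;\Delta_1\vdash t:\mathbf{N}$, $\Gamma;\Delta_2,\Delta_3,\Delta_4\vdash s,r,q:A$ respectively, $A$ $\square$-free, infer $\Gamma;\Delta_1,\ldots,\Delta_4\vdash\mathtt{case}_A\ldots:A$); recursion (from $\Gamma_1;\Delta_1\vdash t:\mathbf{N}$, $\Gamma_1,\Gamma_2;\Delta_2\vdash s:A$, $\Gamma_1,\Gamma_2;\emptyset\vdash r:\square\mathbf{N}\rightarrow\blacksquare A\rightarrow A$, $\Gamma_1,\Delta_1<:\square$, $A$ $\square$-free, infer $\Gamma_1,\Gamma_2;\Delta_1,\Delta_2\vdash\mathtt{recursion}_A\,t\,s\,r:A$); application (from $\Gamma;\Delta_1\vdash t:aA\rightarrow B$, $\Gamma;\Delta_2\vdash s:A$, $\Gamma,\Delta_2<:a$, infer $\Gamma;\Delta_1,\Delta_2\vdash ts:B$). Well-typed means $\Gamma\vdash t:A$ for some $\Gamma,A$. One-step reduction $t\rightarrow t_1,\ldots,t_n$ ($n\in\{1,2\}$) has axioms ($n$ numerals): $\mathtt{case}_A\,0\ \mathtt{zero}\ t\ \mathtt{even}\ s\ \mathtt{odd}\ r\rightarrow t$; $\mathtt{case}_A\,(S_0n)\ldots\rightarrow s$; $\mathtt{case}_A\,(S_1n)\ldots\rightarrow r$; $\mathtt{recursion}_A\,0\,g\,f\rightarrow g$; $\mathtt{recursion}_A\,n\,g\,f\rightarrow fn(\mathtt{recursion}_A\lfloor n/2\rfloor gf)$ ($n\ge1$);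 $S_0n\rightarrow2n$; $S_1n\rightarrow2n+1$; $P0\rightarrow0$; $Pn\rightarrow\lfloor n/2\rfloor$; $(\lambda x:a\mathbf{N}.t)n\rightarrow t[x:=n]$; $(\lambda x:aH.t)s\rightarrow t[x:=s]$; $(\lambda x:aA.t)sr\rightarrow(\lambda x:aA.tr)s$; $\mathtt{rand}\rightarrow0,1$; it is closed under all term contexts except the second and third arguments of $\mathtt{recursion}$ (if $t\rightarrow t_1,\ldots,t_n$ then $C[t]\rightarrow C[t_1],\ldots,C[t_n]$). -}

module Defs where

open import Data.Nat using (ℕ; zero; suc; _*_; _+_; ⌊_/2⌋; NonZero)
open import Data.Fin using (Fin; zero; suc)
open import Data.Vec using (Vec; []; _∷_; lookup)
open import Data.Maybe using (Maybe; just; nothing)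
open import Data.Product using (_×_; _,_; Σ; ∃; ∃-syntax)
open import Data.Sum using (_⊎_)
open import Data.List using (List; []; _∷_; map)
open import Data.Unit using (⊤)
open import Relation.Binary.PropositionalEquality using (_≡_)

data Asp : Set where
  □ ■ : Asp

data _<:ₐ_ : Asp → Asp → Set where
  □<:□ : □ <:ₐ □
  □<:■ : □ <:ₐ ■
  ■<:■ : ■ <:ₐ ■

data Ty : Set where
  N   : Ty
  arr : Asp → Ty → Ty → Ty

data _<:_ : Ty → Ty → Set where
  <:-refl  : ∀ {A} → A <: A
  <:-trans : ∀ {A B C} → A <: B → B <: C → A <: C
  <:-arr   : ∀ {a b A B C D} → B <: A → C <: D → b <:ₐ a →
             arr a A C <: arr b B D

□-free : Ty → Set
□-free N = ⊤
□-free (arr a A B) = (a ≡ ■) × □-free A × □-free B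

-- Terms (de Bruijn indices; Tm n = terms with free variables in Fin n)

data Tm (n : ℕ) : Set where
  var  : Fin n → Tm n
  num  : ℕ → Tm n
  S₀ S₁ P rand : Tm n
  app  : Tm n → Tm n → Tm n
  lam  : Asp → Ty → Tm (suc n) → Tm n
  case : Ty → Tm n → Tm n → Tm n → Tm n → Tm n
         -- case_A t zero s even r odd q
  recursion : Ty → Tm n → Tm n → Tm n → Tm n

ext : ∀ {m n} → (Fin m → Fin n) → Fin (suc m) → Fin (suc n)
ext ρ zero = zero
ext ρ (suc i) = suc (ρ i)

ren : ∀ {m n} → (Fin m → Fin n) → Tm m → Tm n
ren ρ (var i) = var (ρ i)
ren ρ (num k) = num k
ren ρ S₀ = S₀
ren ρ S₁ = S₁
ren ρ P = P
ren ρ rand = rand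
ren ρ (app t s) = app (ren ρ t) (ren ρ s)
ren ρ (lam a A t) = lam a A (ren (ext ρ) t)
ren ρ (case A t s r q) = case A (ren ρ t) (ren ρ s) (ren ρ r) (ren ρ q)
ren ρ (recursion A t s r) = recursion A (ren ρ t) (ren ρ s) (ren ρ r)

wk : ∀ {n} → Tm n → Tm (suc n)
wk = ren suc

exts : ∀ {m n} → (Fin m → Tm n) → Fin (suc m) → Tm (suc n)
exts σ zero = var zero
exts σ (suc i) = wk (σ i)

sub : ∀ {m n} → (Fin m → Tm n) → Tm m → Tm n
sub σ (var i) = σ i
sub σ (num k) = num k
sub σ S₀ = S₀
sub σ S₁ = S₁
sub σ P = P
sub σ rand = rand
sub σ (app t s) = app (sub σ t) (sub σ s)
sub σ (lam a A t) = lam a A (sub (exts σ) t)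
sub σ (case A t s r q) = case A (sub σ t) (sub σ s) (sub σ r) (sub σ q)
sub σ (recursion A t s r) = recursion A (sub σ t) (sub σ s) (sub σ r)

single : ∀ {n} → Tm n → Fin (suc n) → Tm n
single s zero = s
single s (suc i) = var i

_[0≔_] : ∀ {n} → Tm (suc n) → Tm n → Tm n
t [0≔ s ] = sub (single s) t

-- Contexts: a context for Tm n is a finite set of bindings x : a A,
-- represented as a partial assignment of (aspect, type) to the variables.

Ctx : ℕ → Set
Ctx n = Vec (Maybe (Asp × Ty)) n

∅ : ∀ {n} → Ctx n
∅ {zero} = []
∅ {suc n} = nothing ∷ ∅

-- Disjoint union: Union Θ₁ Θ₂ Θ  means  Θ = Θ₁ , Θ₂  (domains disjoint)
data Union : ∀ {n} → Ctx n → Ctx n → Ctx n → Set where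
  []   : Union [] [] []
  none : ∀ {n} {Θ₁ Θ₂ Θ : Ctx n} → Union Θ₁ Θ₂ Θ →
         Union (nothing ∷ Θ₁) (nothing ∷ Θ₂) (nothing ∷ Θ)
  left : ∀ {n e} {Θ₁ Θ₂ Θ : Ctx n} → Union Θ₁ Θ₂ Θ →
         Union (just e ∷ Θ₁) (nothing ∷ Θ₂) (just e ∷ Θ)
  right : ∀ {n e} {Θ₁ Θ₂ Θ : Ctx n} → Union Θ₁ Θ₂ Θ →
         Union (nothing ∷ Θ₁) (just e ∷ Θ₂) (just e ∷ Θ)

data AllE (Q : Asp → Ty → Set) : ∀ {n} → Ctx n → Set where
  []   : AllE Q []
  none : ∀ {n} {Θ : Ctx n} → AllE Q Θ → AllE Q (nothing ∷ Θ)
  some : ∀ {n a A} {Θ : Ctx n} → Q a A → AllE Q Θ → AllE Q (just (a , A) ∷ Θ)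

N-only : ∀ {n} → Ctx n → Set
N-only = AllE (λ _ A → A ≡ N)

_<:ᶜ_ : ∀ {n} → Ctx n → Asp → Set
Γ <:ᶜ a = AllE (λ b _ → b <:ₐ a) Γ

infix 4 _⊢_∶_

data _⊢_∶_ {n : ℕ} : Ctx n → Tm n → Ty → Set where
  ⊢var : ∀ {Θ i a A} → lookup Θ i ≡ just (a , A) → Θ ⊢ var i ∶ A
  ⊢sub : ∀ {Θ t A B} → Θ ⊢ t ∶ A → A <: B → Θ ⊢ t ∶ B
  ⊢lam : ∀ {Θ a A B t} → (just (a , A) ∷ Θ) ⊢ t ∶ B → Θ ⊢ lam a A t ∶ arr a A B
  ⊢num  : ∀ {Θ k} → Θ ⊢ num k ∶ N
  ⊢rand : ∀ {Θ} → Θ ⊢ rand ∶ N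
  ⊢S₀   : ∀ {Θ} → Θ ⊢ S₀ ∶ arr ■ N N
  ⊢S₁   : ∀ {Θ} → Θ ⊢ S₁ ∶ arr ■ N N
  ⊢P    : ∀ {Θ} → Θ ⊢ P ∶ arr ■ N N
  -- Γ;Δ₁ ⊢ t : N,  Γ;Δ₂ ⊢ s : A,  Γ;Δ₃ ⊢ r : A,  Γ;Δ₄ ⊢ q : A,  A □-free
  -- ⟹ Γ;Δ₁,Δ₂,Δ₃,Δ₄ ⊢ case_A t zero s even r odd q : A
  ⊢case : ∀ {Γ Δ₁ Δ₂ Δ₃ Δ₄ D₁₂ D₁₂₃ D Θ Θ₁ Θ₂ Θ₃ Θ₄ A t s r q} →
          N-only Γ →
          Union Δ₁ Δ₂ D₁₂ → Union D₁₂ Δ₃ D₁₂₃ → Union D₁₂₃ Δ₄ D → Union Γ D Θ →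
          Union Γ Δ₁ Θ₁ → Union Γ Δ₂ Θ₂ → Union Γ Δ₃ Θ₃ → Union Γ Δ₄ Θ₄ →
          Θ₁ ⊢ t ∶ N → Θ₂ ⊢ s ∶ A → Θ₃ ⊢ r ∶ A → Θ₄ ⊢ q ∶ A →
          □-free A →
          Θ ⊢ case A t s r q ∶ A
  -- Γ₁;Δ₁ ⊢ t : N,  Γ₁,Γ₂;Δ₂ ⊢ s : A,  Γ₁,Γ₂;∅ ⊢ r : □N → ■A → A,
  -- Γ₁,Δ₁ <: □,  A □-free  ⟹  Γ₁,Γ₂;Δ₁,Δ₂ ⊢ recursion_A t s r : A
  ⊢rec : ∀ {Γ₁ Γ₂ Δ₁ Δ₂ G D Θ Θ₁ Θ₂ A t s r} →
         N-only Γ₁ → N-only Γ₂ →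
         Union Γ₁ Γ₂ G → Union Δ₁ Δ₂ D → Union G D Θ →
         Union Γ₁ Δ₁ Θ₁ → Union G Δ₂ Θ₂ →
         Θ₁ ⊢ t ∶ N → Θ₂ ⊢ s ∶ A → G ⊢ r ∶ arr □ N (arr ■ A A) →
         Γ₁ <:ᶜ □ → Δ₁ <:ᶜ □ → □-free A →
         Θ ⊢ recursion A t s r ∶ A
  -- Γ;Δ₁ ⊢ t : aA → B,  Γ;Δ₂ ⊢ s : A,  Γ,Δ₂ <: a  ⟹  Γ;Δ₁,Δ₂ ⊢ ts : B
  ⊢app : ∀ {Γ Δ₁ Δ₂ D Θ Θ₁ Θ₂ a A B t s} →
         N-only Γ →
         Union Δ₁ Δ₂ D → Union Γ D Θ →
         Union Γ Δ₁ Θ₁ → Union Γ Δ₂ Θ₂ →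
         Θ₁ ⊢ t ∶ arr a A B → Θ₂ ⊢ s ∶ A →
         Γ <:ᶜ a → Δ₂ <:ᶜ a →
         Θ ⊢ app t s ∶ B

WellTyped : ∀ {n} → Tm n → Set
WellTyped {n} t = Σ (Ctx n) λ Θ → Σ Ty λ A → Θ ⊢ t ∶ A

-- One-step reduction  t → t₁,…,tₖ  (k ∈ {1,2}), as a list of results

infix 4 _⟶_

data _⟶_ {n : ℕ} : Tm n → List (Tm n) → Set where
  case-zero : ∀ {A t s r} → case A (num 0) t s r ⟶ t ∷ []
  case-even : ∀ {A k t s r} → case A (app S₀ (num k)) t s r ⟶ s ∷ []
  case-odd  : ∀ {A k t s r} → case A (app S₁ (num k)) t s r ⟶ r ∷ []
  rec-zero  : ∀ {A g f} → recursion A (num 0) g f ⟶ g ∷ []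
  rec-suc   : ∀ {A k g f} →
              recursion A (num (suc k)) g f ⟶
              app (app f (num (suc k))) (recursion A (num ⌊ suc k /2⌋) g f) ∷ []
  S₀-num : ∀ {k} → app S₀ (num k) ⟶ num (2 * k) ∷ []
  S₁-num : ∀ {k} → app S₁ (num k) ⟶ num (2 * k + 1) ∷ []
  P-zero : app P (num 0) ⟶ num 0 ∷ []
  P-num  : ∀ {k} → app P (num (suc k)) ⟶ num ⌊ suc k /2⌋ ∷ []
  β-N    : ∀ {a t k} → app (lam a N t) (num k) ⟶ (t [0≔ num k ]) ∷ []
  β-H    : ∀ {a b B C t s} → app (lam a (arr b B C) t) s ⟶ (t [0≔ s ]) ∷ []
  β-perm : ∀ {a A t s r} →
           app (app (lam a A t) s) r ⟶ app (lam a A (app t (wk r))) s ∷ []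
  rand-r : rand ⟶ num 0 ∷ num 1 ∷ []
  -- closure under term contexts (not 2nd/3rd argument of recursion)
  ξ-appL : ∀ {t s ts} → t ⟶ ts → app t s ⟶ map (λ u → app u s) ts
  ξ-appR : ∀ {t s ss} → s ⟶ ss → app t s ⟶ map (λ u → app t u) ss
  ξ-lam  : ∀ {a A} {t : Tm (suc n)} {ts} → t ⟶ ts → lam a A t ⟶ map (lam a A) ts
  ξ-case₁ : ∀ {A t s r q ts} → t ⟶ ts → case A t s r q ⟶ map (λ u → case A u s r q) ts
  ξ-case₂ : ∀ {A t s r q ss} → s ⟶ ss → case A t s r q ⟶ map (λ u → case A t u r q) ss
  ξ-case₃ : ∀ {A t s r q rs} → r ⟶ rs → case A t s r q ⟶ map (λ u → case A t s u q) rs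
  ξ-case₄ : ∀ {A t s r q qs} → q ⟶ qs → case A t s r q ⟶ map (λ u → case A t s r u) qs
  ξ-rec   : ∀ {A t s r ts} → t ⟶ ts → recursion A t s r ⟶ map (λ u → recursion A u s r) ts

module Submission where

-- The only rule with two results is rand ⟶ 0, 1; every binary step is that
-- rule fired at one occurrence of rand, reached through the congruence rules.
-- Two different binary steps from the same term cannot fire the same
-- occurrence (that gives the same results), so they fire occurrences in
-- disjoint subterms. Such steps commute: firing either one after the other
-- yields four terms forming the required square.

open import Defs
open import Data.Nat using (ℕ; suc)
open import Data.List using (List; []; _∷_; map)
open import Data.Product using (_×_; _,_; ∃-syntax)
open import Data.Product as Product using ()
open import Data.Sum using (_⊎_; inj₁)
open import Function using (_∘_)
open import Relation.Nullary using (¬_)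
open import Relation.Binary.PropositionalEquality using (_≡_; refl; cong)

data Fork {n : ℕ} : Tm n → Tm n → Tm n → Set where
  fork-rand : Fork rand (num 0) (num 1)
  fork-appL : ∀ {t t₀ t₁ s} → Fork t t₀ t₁ → Fork (app t s) (app t₀ s) (app t₁ s)
  fork-appR : ∀ {t s s₀ s₁} → Fork s s₀ s₁ → Fork (app t s) (app t s₀) (app t s₁)
  fork-lam  : ∀ {a A} {t t₀ t₁ : Tm (suc n)} →
              Fork t t₀ t₁ → Fork (lam a A t) (lam a A t₀) (lam a A t₁)
  fork-case₁ : ∀ {A t s r q x y} → Fork t x y →
               Fork (case A t s r q) (case A x s r q) (case A y s r q)
  fork-case₂ : ∀ {A t s r q x y} → Fork s x y →
               Fork (case A t s r q) (case A t x r q) (case A t y r q)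
  fork-case₃ : ∀ {A t s r q x y} → Fork r x y →
               Fork (case A t s r q) (case A t s x q) (case A t s y q)
  fork-case₄ : ∀ {A t s r q x y} → Fork q x y →
               Fork (case A t s r q) (case A t s r x) (case A t s r y)
  fork-rec : ∀ {A t s r x y} → Fork t x y →
             Fork (recursion A t s r) (recursion A x s r) (recursion A y s r)

Fork-compatible : ∀ {m k} → (Tm m → Tm k) → Set
Fork-compatible f = ∀ {x y z} → Fork x y z → Fork (f x) (f y) (f z)

fork⇒⟶ : ∀ {n} {t v₁ v₂ : Tm n} → Fork t v₁ v₂ → t ⟶ v₁ ∷ v₂ ∷ []
fork⇒⟶ fork-rand = rand-r
fork⇒⟶ (fork-appL d) = ξ-appL (fork⇒⟶ d)
fork⇒⟶ (fork-appR d) = ξ-appR (fork⇒⟶ d)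
fork⇒⟶ (fork-lam d) = ξ-lam (fork⇒⟶ d)
fork⇒⟶ (fork-case₁ d) = ξ-case₁ (fork⇒⟶ d)
fork⇒⟶ (fork-case₂ d) = ξ-case₂ (fork⇒⟶ d)
fork⇒⟶ (fork-case₃ d) = ξ-case₃ (fork⇒⟶ d)
fork⇒⟶ (fork-case₄ d) = ξ-case₄ (fork⇒⟶ d)
fork⇒⟶ (fork-rec d) = ξ-rec (fork⇒⟶ d)

map-fork : ∀ {m k} {t : Tm m} {ts : List (Tm m)} {v₁ v₂ : Tm k}
           (f : Tm m → Tm k) → Fork-compatible f →
           (∀ {u₁ u₂} → ts ≡ u₁ ∷ u₂ ∷ [] → Fork t u₁ u₂) →
           map f ts ≡ v₁ ∷ v₂ ∷ [] → Fork (f t) v₁ v₂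
map-fork {ts = []} f compat fork ()
map-fork {ts = _ ∷ []} f compat fork ()
map-fork {ts = _ ∷ _ ∷ []} f compat fork refl = compat (fork refl)
map-fork {ts = _ ∷ _ ∷ _ ∷ _} f compat fork ()

⟶⇒fork : ∀ {n} {t : Tm n} {ts v₁ v₂} → t ⟶ ts → ts ≡ v₁ ∷ v₂ ∷ [] → Fork t v₁ v₂
⟶⇒fork case-zero ()
⟶⇒fork case-even ()
⟶⇒fork case-odd ()
⟶⇒fork rec-zero ()
⟶⇒fork rec-suc ()
⟶⇒fork S₀-num ()
⟶⇒fork S₁-num ()
⟶⇒fork P-zero ()
⟶⇒fork P-num ()
⟶⇒fork β-N ()
⟶⇒fork β-H ()
⟶⇒fork β-perm ()
⟶⇒fork rand-r refl = fork-rand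
⟶⇒fork (ξ-appL d) = map-fork _ fork-appL (⟶⇒fork d)
⟶⇒fork (ξ-appR d) = map-fork _ fork-appR (⟶⇒fork d)
⟶⇒fork (ξ-lam d) = map-fork _ fork-lam (⟶⇒fork d)
⟶⇒fork (ξ-case₁ d) = map-fork _ fork-case₁ (⟶⇒fork d)
⟶⇒fork (ξ-case₂ d) = map-fork _ fork-case₂ (⟶⇒fork d)
⟶⇒fork (ξ-case₃ d) = map-fork _ fork-case₃ (⟶⇒fork d)
⟶⇒fork (ξ-case₄ d) = map-fork _ fork-case₄ (⟶⇒fork d)
⟶⇒fork (ξ-rec d) = map-fork _ fork-rec (⟶⇒fork d)

Diamond : ∀ {n} → Tm n → Tm n → Tm n → Tm n → Set
Diamond v₁ v₂ z₁ z₂ = ∃[ a₁ ] ∃[ a₂ ] ∃[ a₃ ] ∃[ a₄ ]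
  (Fork v₁ a₁ a₂ × Fork v₂ a₃ a₄ × Fork z₁ a₁ a₃ × Fork z₂ a₂ a₄)

Diamond-map : ∀ {m k} (f : Tm m → Tm k) → Fork-compatible f →
              ∀ {v₁ v₂ z₁ z₂} → Diamond v₁ v₂ z₁ z₂ →
              Diamond (f v₁) (f v₂) (f z₁) (f z₂)
Diamond-map f compat (a₁ , a₂ , a₃ , a₄ , p , q , r , s) =
  f a₁ , f a₂ , f a₃ , f a₄ , compat p , compat q , compat r , compat s

Diamond-under : ∀ {m k} (f : Tm m → Tm k) → Fork-compatible f →
                ∀ {v₁ v₂ z₁ z₂} →
                (¬ (v₁ ≡ z₁ × v₂ ≡ z₂) → Diamond v₁ v₂ z₁ z₂) →
                ¬ (f v₁ ≡ f z₁ × f v₂ ≡ f z₂) →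
                Diamond (f v₁) (f v₂) (f z₁) (f z₂)
Diamond-under f compat diamond distinct =
  Diamond-map f compat (diamond (distinct ∘ Product.map (cong f) (cong f)))

Diamond-disjoint : ∀ {n} (f : Tm n → Tm n → Tm n) →
                   (∀ {y} → Fork-compatible (λ x → f x y)) →
                   (∀ {x} → Fork-compatible (f x)) →
                   ∀ {x x₀ x₁ y y₀ y₁} → Fork x x₀ x₁ → Fork y y₀ y₁ →
                   Diamond (f x₀ y) (f x₁ y) (f x y₀) (f x y₁)
Diamond-disjoint f compatˡ compatʳ {x₀ = x₀} {x₁} {y₀ = y₀} {y₁} dx dy =
  f x₀ y₀ , f x₀ y₁ , f x₁ y₀ , f x₁ y₁ ,
  compatʳ dy , compatʳ dy , compatˡ dx , compatˡ dx

fork-diamond : ∀ {n} {t v₁ v₂ z₁ z₂ : Tm n} → Fork t v₁ v₂ → Fork t z₁ z₂ →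
               ¬ (v₁ ≡ z₁ × v₂ ≡ z₂) → Diamond v₁ v₂ z₁ z₂
fork-diamond fork-rand fork-rand distinct with () ← distinct (refl , refl)
fork-diamond (fork-appL d) (fork-appL e) = Diamond-under _ fork-appL (fork-diamond d e)
fork-diamond (fork-appR d) (fork-appR e) = Diamond-under _ fork-appR (fork-diamond d e)
fork-diamond (fork-lam d) (fork-lam e) = Diamond-under _ fork-lam (fork-diamond d e)
fork-diamond (fork-case₁ d) (fork-case₁ e) = Diamond-under _ fork-case₁ (fork-diamond d e)
fork-diamond (fork-case₂ d) (fork-case₂ e) = Diamond-under _ fork-case₂ (fork-diamond d e)
fork-diamond (fork-case₃ d) (fork-case₃ e) = Diamond-under _ fork-case₃ (fork-diamond d e)
fork-diamond (fork-case₄ d) (fork-case₄ e) = Diamond-under _ fork-case₄ (fork-diamond d e)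
fork-diamond (fork-rec d) (fork-rec e) = Diamond-under _ fork-rec (fork-diamond d e)
fork-diamond (fork-appL d) (fork-appR e) _ = Diamond-disjoint app fork-appL fork-appR d e
fork-diamond (fork-appR d) (fork-appL e) _ =
  Diamond-disjoint (λ x y → app y x) fork-appR fork-appL d e
fork-diamond (fork-case₁ d) (fork-case₂ e) _ =
  Diamond-disjoint (λ x y → case _ x y _ _) fork-case₁ fork-case₂ d e
fork-diamond (fork-case₁ d) (fork-case₃ e) _ =
  Diamond-disjoint (λ x y → case _ x _ y _) fork-case₁ fork-case₃ d e
fork-diamond (fork-case₁ d) (fork-case₄ e) _ =
  Diamond-disjoint (λ x y → case _ x _ _ y) fork-case₁ fork-case₄ d e
fork-diamond (fork-case₂ d) (fork-case₁ e) _ =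
  Diamond-disjoint (λ x y → case _ y x _ _) fork-case₂ fork-case₁ d e
fork-diamond (fork-case₂ d) (fork-case₃ e) _ =
  Diamond-disjoint (λ x y → case _ _ x y _) fork-case₂ fork-case₃ d e
fork-diamond (fork-case₂ d) (fork-case₄ e) _ =
  Diamond-disjoint (λ x y → case _ _ x _ y) fork-case₂ fork-case₄ d e
fork-diamond (fork-case₃ d) (fork-case₁ e) _ =
  Diamond-disjoint (λ x y → case _ y _ x _) fork-case₃ fork-case₁ d e
fork-diamond (fork-case₃ d) (fork-case₂ e) _ =
  Diamond-disjoint (λ x y → case _ _ y x _) fork-case₃ fork-case₂ d e
fork-diamond (fork-case₃ d) (fork-case₄ e) _ =
  Diamond-disjoint (λ x y → case _ _ _ x y) fork-case₃ fork-case₄ d e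
fork-diamond (fork-case₄ d) (fork-case₁ e) _ =
  Diamond-disjoint (λ x y → case _ y _ _ x) fork-case₄ fork-case₁ d e
fork-diamond (fork-case₄ d) (fork-case₂ e) _ =
  Diamond-disjoint (λ x y → case _ _ y _ x) fork-case₄ fork-case₂ d e
fork-diamond (fork-case₄ d) (fork-case₃ e) _ =
  Diamond-disjoint (λ x y → case _ _ _ y x) fork-case₄ fork-case₃ d e

mainTheorem15 : ∀ {n : ℕ} (t v₁ v₂ z₁ z₂ : Tm n) →
    WellTyped t →
    t ⟶ v₁ ∷ v₂ ∷ [] →
    t ⟶ z₁ ∷ z₂ ∷ [] →
    ¬ (v₁ ≡ z₁ × v₂ ≡ z₂) →
    ∃[ a₁ ] ∃[ a₂ ] ∃[ a₃ ] ∃[ a₄ ]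
    ( v₁ ⟶ a₁ ∷ a₂ ∷ []
    × v₂ ⟶ a₃ ∷ a₄ ∷ []
    × ( (z₁ ⟶ a₁ ∷ a₃ ∷ [] × z₂ ⟶ a₂ ∷ a₄ ∷ [])
    ⊎ (z₂ ⟶ a₁ ∷ a₃ ∷ [] × z₁ ⟶ a₂ ∷ a₄ ∷ []) ) )
mainTheorem15 t v₁ v₂ z₁ z₂ _ tv tz distinct
  with a₁ , a₂ , a₃ , a₄ , v₁a , v₂a , z₁a , z₂a
         ← fork-diamond (⟶⇒fork tv refl) (⟶⇒fork tz refl) distinct =
  a₁ , a₂ , a₃ , a₄ , fork⇒⟶ v₁a , fork⇒⟶ v₂a ,
  inj₁ (fork⇒⟶ z₁a , fork⇒⟶ z₂a)
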